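{- For every realization $\star$, every theorem $\varphi$ of $\mathbf{S5[Con,Ground]}$ satisfies $\mathbf{FIX}\Vdash_\star\varphi$.
   Context: Kripke fixed points. Let $\mathcal{L}_T$ be the first-order language of arithmetic augmented with a unary predicate $\mathsf{True}$, with a standard Gödel numbering $\varphi\mapsto\ulcorner\varphi\urcorner$. Sentences are evaluated in strong Kleene three-valued logic $\mathsf{K3}$ (values \textsc{true}, \textsc{false}, \textsc{neither}; $\wedge$ true iff both true, false iff one false; $\neg$ swaps true/false; $\forall$ true iff all instances true, false iff some instance false; otherwise neither). For $S\subseteq\mathbb{N}$ let $\mathbb{N}_S$ interpret arithmetic standardly and make $\mathsf{True}(n)$ true iff $n\in S$, false iff $n$ is not a sentence code or $n=\ulcorner\varphi\urcorner$ with $\ulcorner\neg\varphi\urcorner\in S$, neither otherwise. A fixed point is a set $S$ of sentence codes with $S=\{\ulcorner\varphi\urcorner:\varphi\text{ true in }\mathbb{N}_S\}$ and no $\varphi$ with both $\ulcorner\varphi\urcorner,\ulcorner\neg\varphi\urcorner\in S$; a sentence's value in $S$ is its value in $\mathbb{N}_S$. $\mathbf{FIX}$ is the set of all fixed points. Modal language and semantics. $\mathcal{L}_\Box$: formulas $\varphi::=T(x)\mid F(x)\mid\neg\varphi\mid(\varphi\wedge\varphi)\mid\Box\varphi$ over a countably infinite set of variables; $\lozenge$ etc. abbreviations; $N(x):=\neg T(x)\wedge\neg F(x)$. A realization $\star$ assigns each variable $x$ an $\mathcal{L}_T$ sentence $x^\star$. For $w\in\mathbf{FIX}$: $w\Vdash_\star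 T(x)$ iff $x^\star$ is \textsc{true} in $w$; $w\Vdash_\star F(x)$ iff $x^\star$ is \textsc{false} in $w$; Boolean connectives classical; $w\Vdash_\star\Box\varphi$ iff $v\Vdash_\star\varphi$ for all $v\in\mathbf{FIX}$. $\mathbf{FIX}\Vdash_\star\varphi$ means $w\Vdash_\star\varphi$ for all $w\in\mathbf{FIX}$. Axioms. $\mathbf{S5}$ is the least set of $\mathcal{L}_\Box$ formulas containing all substitution instances of propositional tautologies and all instances of $\Box(A\to B)\to(\Box A\to\Box B)$, $\Box A\to A$, $\lozenge A\to\Box\lozenge A$, closed under modus ponens and necessitation. $\mathbf{S5[Con,Ground]}$ adds, for every variable $x$, the axioms $\neg(T(x)\wedge F(x))$ and $(\lozenge T(x)\wedge\lozenge F(x))\to\lozenge N(x)$, closed under the same rules. -}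

module Defs where

open import Level using (Level; 0ℓ; Lift) renaming (suc to lsuc)
open import Data.Nat using (ℕ; zero; suc; _+_; _*_)
open import Data.Fin using (Fin; toℕ)
open import Data.Vec using (Vec; []; _∷_; lookup)
open import Data.Bool using (Bool; true; false; not; _∧_)
open import Data.Product using (Σ; _×_; _,_)
open import Data.Sum using (_⊎_)
open import Data.Empty using (⊥)
open import Relation.Nullary using (¬_)
open import Relation.Binary.PropositionalEquality using (_≡_)
open import Function.Bundles using (_⇔_)

data Term (n : ℕ) : Set where
  var  : Fin n → Term n
  zer  : Term n
  succ : Term n → Term n
  plus : Term n → Term n → Term n
  times : Term n → Term n → Term n

data Form (n : ℕ) : Set where
  eq   : Term n → Term n → Form n
  Tr   : Term n → Form n
  neg  : Form n → Form n
  conj : Form n → Form n → Form n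
  all  : Form (suc n) → Form n

Sentence : Set
Sentence = Form 0

tri : ℕ → ℕ
tri zero = zero
tri (suc k) = suc k + tri k

pair : ℕ → ℕ → ℕ
pair a b = tri (a + b) + b

codeTerm : ∀ {n} → Term n → ℕ
codeTerm (var i) = pair 0 (toℕ i)
codeTerm zer = pair 1 0
codeTerm (succ t) = pair 2 (codeTerm t)
codeTerm (plus t u) = pair 3 (pair (codeTerm t) (codeTerm u))
codeTerm (times t u) = pair 4 (pair (codeTerm t) (codeTerm u))

code : ∀ {n} → Form n → ℕ
code (eq t u) = pair 0 (pair (codeTerm t) (codeTerm u))
code (Tr t) = pair 1 (codeTerm t)
code (neg φ) = pair 2 (code φ)
code (conj φ ψ) = pair 3 (pair (code φ) (code ψ))
code (all φ) = pair 4 (code φ)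

⌜_⌝ : Sentence → ℕ
⌜ φ ⌝ = code φ

IsSentenceCode : ℕ → Set
IsSentenceCode m = Σ Sentence (λ φ → ⌜ φ ⌝ ≡ m)

-- Strong Kleene (K3) evaluation in N_S, S ⊆ ℕ given as a predicate.
-- A formula gets value true (IsTrue), false (IsFalse) or neither.

evalT : ∀ {n} → Vec ℕ n → Term n → ℕ
evalT ρ (var i) = lookup ρ i
evalT ρ zer = zero
evalT ρ (succ t) = suc (evalT ρ t)
evalT ρ (plus t u) = evalT ρ t + evalT ρ u
evalT ρ (times t u) = evalT ρ t * evalT ρ u

TrFalse : (ℕ → Set) → ℕ → Set
TrFalse S m = ¬ IsSentenceCode m ⊎ Σ Sentence (λ φ → ⌜ φ ⌝ ≡ m × S ⌜ neg φ ⌝)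

mutual
  IsTrue : (ℕ → Set) → ∀ {n} → Vec ℕ n → Form n → Set
  IsTrue S ρ (eq t u) = evalT ρ t ≡ evalT ρ u
  IsTrue S ρ (Tr t) = S (evalT ρ t)
  IsTrue S ρ (neg φ) = IsFalse S ρ φ
  IsTrue S ρ (conj φ ψ) = IsTrue S ρ φ × IsTrue S ρ ψ
  IsTrue S ρ (all φ) = (k : ℕ) → IsTrue S (k ∷ ρ) φ

  IsFalse : (ℕ → Set) → ∀ {n} → Vec ℕ n → Form n → Set
  IsFalse S ρ (eq t u) = ¬ (evalT ρ t ≡ evalT ρ u)
  IsFalse S ρ (Tr t) = TrFalse S (evalT ρ t)
  IsFalse S ρ (neg φ) = IsTrue S ρ φ
  IsFalse S ρ (conj φ ψ) = IsFalse S ρ φ ⊎ IsFalse S ρ ψ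
  IsFalse S ρ (all φ) = Σ ℕ (λ k → IsFalse S (k ∷ ρ) φ)

TrueIn FalseIn : (ℕ → Set) → Sentence → Set
TrueIn S φ = IsTrue S [] φ
FalseIn S φ = IsFalse S [] φ

record FixedPoint : Set₁ where
  field
    S          : ℕ → Set
    onlyCodes  : ∀ m → S m → IsSentenceCode m
    fixed      : (φ : Sentence) → S ⌜ φ ⌝ ⇔ TrueIn S φ
    consistent : (φ : Sentence) → ¬ (S ⌜ φ ⌝ × S ⌜ neg φ ⌝)

FIX : Set₁
FIX = FixedPoint

data MForm : Set where
  T F  : ℕ → MForm
  ¬ₘ   : MForm → MForm
  _∧ₘ_ : MForm → MForm → MForm
  □    : MForm → MForm

infixr 6 _∧ₘ_
infixr 4 _⇒_

_⇒_ : MForm → MForm → MForm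
A ⇒ B = ¬ₘ (A ∧ₘ ¬ₘ B)

◇ : MForm → MForm
◇ A = ¬ₘ (□ (¬ₘ A))

N : ℕ → MForm
N x = ¬ₘ (T x) ∧ₘ ¬ₘ (F x)

data PForm : Set where
  atom : ℕ → PForm
  pneg : PForm → PForm
  pconj : PForm → PForm → PForm

pval : (ℕ → Bool) → PForm → Bool
pval v (atom i) = v i
pval v (pneg p) = not (pval v p)
pval v (pconj p q) = pval v p ∧ pval v q

Tautology : PForm → Set
Tautology p = (v : ℕ → Bool) → pval v p ≡ true

psubst : (ℕ → MForm) → PForm → MForm
psubst σ (atom i) = σ i
psubst σ (pneg p) = ¬ₘ (psubst σ p)
psubst σ (pconj p q) = psubst σ p ∧ₘ psubst σ q

data ThmS5CG : MForm → Set where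
  taut   : (p : PForm) → Tautology p → (σ : ℕ → MForm) → ThmS5CG (psubst σ p)
  axK    : (A B : MForm) → ThmS5CG (□ (A ⇒ B) ⇒ (□ A ⇒ □ B))
  axT    : (A : MForm) → ThmS5CG (□ A ⇒ A)
  ax5    : (A : MForm) → ThmS5CG (◇ A ⇒ □ (◇ A))
  axCon  : (x : ℕ) → ThmS5CG (¬ₘ (T x ∧ₘ F x))
  axGround : (x : ℕ) → ThmS5CG ((◇ (T x) ∧ₘ ◇ (F x)) ⇒ ◇ (N x))
  mp     : {A B : MForm} → ThmS5CG (A ⇒ B) → ThmS5CG A → ThmS5CG B
  nec    : {A : MForm} → ThmS5CG A → ThmS5CG (□ A)

Realization : Set
Realization = ℕ → Sentence

_⊩[_]_ : FIX → Realization → MForm → Set₁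
w ⊩[ ⋆ ] T x = Lift (lsuc 0ℓ) (TrueIn (FixedPoint.S w) (⋆ x))
w ⊩[ ⋆ ] F x = Lift (lsuc 0ℓ) (FalseIn (FixedPoint.S w) (⋆ x))
w ⊩[ ⋆ ] ¬ₘ A = ¬ (w ⊩[ ⋆ ] A)
w ⊩[ ⋆ ] (A ∧ₘ B) = (w ⊩[ ⋆ ] A) × (w ⊩[ ⋆ ] B)
w ⊩[ ⋆ ] □ A = (v : FIX) → v ⊩[ ⋆ ] A

FIX⊩[_]_ : Realization → MForm → Set₁
FIX⊩[ ⋆ ] A = (w : FIX) → w ⊩[ ⋆ ] A

{-# OPTIONS --safe #-}
-- Knaster–Tarski gives the Kripke jump S ↦ {⌜φ⌝ : φ true in ℕ_S}, which is monotone for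
-- strong Kleene evaluation, a least fixed point, contained in every fixed point. Hence a
-- sentence true in one fixed point and false in another is neither true nor false in the
-- least one: otherwise monotonicity would make it true (or false) in every fixed point,
-- against consistency. This is the Ground axiom; the remaining S5 axioms and rules are
-- valid because □ quantifies over all of FIX, and excluded middle makes forcing bivalent,
-- as tautologies, K and modus ponens require.
module Submission where

open import Defs
open import Level using (0ℓ; lift) renaming (suc to lsuc)
open import Axiom.ExcludedMiddle using (ExcludedMiddle)
open import Axiom.DoubleNegationElimination using (DoubleNegationElimination; em⇒dne)
open import Data.Nat using (ℕ; zero; suc; _+_; _≤_; _<_; z≤n; s≤s)
open import Data.Nat.Properties
  using (+-comm; +-mono-≤; +-monoʳ-≤; m≤n+m; m≤m+n; ≤-refl; <-cmp; <⇒≢; +-cancelˡ-≡; +-cancelʳ-≡; module ≤-Reasoning)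
open import Data.Bool using (Bool)
open import Data.Fin using (toℕ)
open import Data.Fin.Properties using (toℕ-injective)
open import Data.Vec using (Vec; []; _∷_)
open import Data.Product using (Σ; _×_; _,_)
open import Data.Sum using (inj₁; inj₂)
open import Function.Bundles using (_⇔_; mk⇔; Equivalence)
open import Relation.Binary.Definitions using (tri<; tri≈; tri>)
open import Relation.Binary.PropositionalEquality
open import Relation.Nullary using (¬_; does; proof; contradiction)
open import Relation.Nullary.Decidable using (True; toWitness; fromWitness)
open import Relation.Nullary.Reflects using (Reflects; invert; ¬-reflects; _×-reflects_)
open import Relation.Unary using (Pred; _⊆_)

tri-mono-≤ : ∀ {s t} → s ≤ t → tri s ≤ tri t
tri-mono-≤ {zero}  _         = z≤n
tri-mono-≤ {suc s} (s≤s s≤t) = +-mono-≤ (s≤s s≤t) (tri-mono-≤ s≤t)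

-- The pairs on the diagonal a + b = s are coded by the interval [tri s, tri s + s].
pair-mono-< : ∀ a b c d → a + b < c + d → pair a b < pair c d
pair-mono-< a b c d a+b<c+d = begin-strict
  tri (a + b) + b       ≤⟨ +-monoʳ-≤ (tri (a + b)) (m≤n+m b a) ⟩
  tri (a + b) + (a + b) ≡⟨ +-comm (tri (a + b)) (a + b) ⟩
  (a + b) + tri (a + b) <⟨ ≤-refl ⟩
  tri (suc (a + b))     ≤⟨ tri-mono-≤ a+b<c+d ⟩
  tri (c + d)           ≤⟨ m≤m+n (tri (c + d)) d ⟩
  pair c d              ∎
  where open ≤-Reasoning

pair-injective : ∀ {a b c d} → pair a b ≡ pair c d → a ≡ c × b ≡ d
pair-injective {a} {b} {c} {d} e with <-cmp (a + b) (c + d)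
... | tri< lt _ _ = contradiction e (<⇒≢ (pair-mono-< a b c d lt))
... | tri> _ _ gt = contradiction (sym e) (<⇒≢ (pair-mono-< c d a b gt))
... | tri≈ _ a+b≡c+d _ = a≡c , b≡d
  where
  b≡d : b ≡ d
  b≡d = +-cancelˡ-≡ (tri (a + b)) b d (trans e (cong (λ s → tri s + d) (sym a+b≡c+d)))
  a≡c : a ≡ c
  a≡c = +-cancelʳ-≡ b a c (trans a+b≡c+d (cong (c +_) (sym b≡d)))

termTag : ∀ {n} → Term n → ℕ
termTag (var _)     = 0
termTag zer         = 1
termTag (succ _)    = 2
termTag (plus _ _)  = 3
termTag (times _ _) = 4

termBody : ∀ {n} → Term n → ℕ
termBody (var i)     = toℕ i
termBody zer         = 0
termBody (succ t)    = codeTerm t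
termBody (plus t u)  = pair (codeTerm t) (codeTerm u)
termBody (times t u) = pair (codeTerm t) (codeTerm u)

codeTerm-tagBody : ∀ {n} (t : Term n) → codeTerm t ≡ pair (termTag t) (termBody t)
codeTerm-tagBody (var _)     = refl
codeTerm-tagBody zer         = refl
codeTerm-tagBody (succ _)    = refl
codeTerm-tagBody (plus _ _)  = refl
codeTerm-tagBody (times _ _) = refl

formTag : ∀ {n} → Form n → ℕ
formTag (eq _ _)   = 0
formTag (Tr _)     = 1
formTag (neg _)    = 2
formTag (conj _ _) = 3
formTag (all _)    = 4

formBody : ∀ {n} → Form n → ℕ
formBody (eq t u)   = pair (codeTerm t) (codeTerm u)
formBody (Tr t)     = codeTerm t
formBody (neg φ)    = code φ
formBody (conj φ ψ) = pair (code φ) (code ψ)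
formBody (all φ)    = code φ

code-tagBody : ∀ {n} (φ : Form n) → code φ ≡ pair (formTag φ) (formBody φ)
code-tagBody (eq _ _)   = refl
code-tagBody (Tr _)     = refl
code-tagBody (neg _)    = refl
code-tagBody (conj _ _) = refl
code-tagBody (all _)    = refl

mutual
  codeTerm-injective : ∀ {n} (t u : Term n) → codeTerm t ≡ codeTerm u → t ≡ u
  codeTerm-injective t u e =
    termTagBody-injective t u (pair-injective (trans (sym (codeTerm-tagBody t)) (trans e (codeTerm-tagBody u))))

  termTagBody-injective : ∀ {n} (t u : Term n) → termTag t ≡ termTag u × termBody t ≡ termBody u → t ≡ u
  termTagBody-injective (var i)     (var j)       (_ , i≡j) = cong var (toℕ-injective i≡j)
  termTagBody-injective zer         zer           _         = refl
  termTagBody-injective (succ t)    (succ u)      (_ , t≡u) = cong succ (codeTerm-injective t u t≡u)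
  termTagBody-injective (plus t u)  (plus t′ u′)  (_ , e) with t≡ , u≡ ← pair-injective e =
    cong₂ plus (codeTerm-injective t t′ t≡) (codeTerm-injective u u′ u≡)
  termTagBody-injective (times t u) (times t′ u′) (_ , e) with t≡ , u≡ ← pair-injective e =
    cong₂ times (codeTerm-injective t t′ t≡) (codeTerm-injective u u′ u≡)
  termTagBody-injective (var _)     zer         (() , _)
  termTagBody-injective (var _)     (succ _)    (() , _)
  termTagBody-injective (var _)     (plus _ _)  (() , _)
  termTagBody-injective (var _)     (times _ _) (() , _)
  termTagBody-injective zer         (var _)     (() , _)
  termTagBody-injective zer         (succ _)    (() , _)
  termTagBody-injective zer         (plus _ _)  (() , _)
  termTagBody-injective zer         (times _ _) (() , _)
  termTagBody-injective (succ _)    (var _)     (() , _)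
  termTagBody-injective (succ _)    zer         (() , _)
  termTagBody-injective (succ _)    (plus _ _)  (() , _)
  termTagBody-injective (succ _)    (times _ _) (() , _)
  termTagBody-injective (plus _ _)  (var _)     (() , _)
  termTagBody-injective (plus _ _)  zer         (() , _)
  termTagBody-injective (plus _ _)  (succ _)    (() , _)
  termTagBody-injective (plus _ _)  (times _ _) (() , _)
  termTagBody-injective (times _ _) (var _)     (() , _)
  termTagBody-injective (times _ _) zer         (() , _)
  termTagBody-injective (times _ _) (succ _)    (() , _)
  termTagBody-injective (times _ _) (plus _ _)  (() , _)

mutual
  code-injective : ∀ {n} (φ ψ : Form n) → code φ ≡ code ψ → φ ≡ ψ
  code-injective φ ψ e =
    formTagBody-injective φ ψ (pair-injective (trans (sym (code-tagBody φ)) (trans e (code-tagBody ψ))))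

  formTagBody-injective : ∀ {n} (φ ψ : Form n) → formTag φ ≡ formTag ψ × formBody φ ≡ formBody ψ → φ ≡ ψ
  formTagBody-injective (eq t u)   (eq t′ u′)   (_ , e) with t≡ , u≡ ← pair-injective e =
    cong₂ eq (codeTerm-injective t t′ t≡) (codeTerm-injective u u′ u≡)
  formTagBody-injective (Tr t)     (Tr t′)      (_ , t≡) = cong Tr (codeTerm-injective t t′ t≡)
  formTagBody-injective (neg φ)    (neg φ′)     (_ , φ≡) = cong neg (code-injective φ φ′ φ≡)
  formTagBody-injective (conj φ ψ) (conj φ′ ψ′) (_ , e) with φ≡ , ψ≡ ← pair-injective e =
    cong₂ conj (code-injective φ φ′ φ≡) (code-injective ψ ψ′ ψ≡)
  formTagBody-injective (all φ)    (all φ′)     (_ , φ≡) = cong all (code-injective φ φ′ φ≡)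
  formTagBody-injective (eq _ _)   (Tr _)       (() , _)
  formTagBody-injective (eq _ _)   (neg _)      (() , _)
  formTagBody-injective (eq _ _)   (conj _ _)   (() , _)
  formTagBody-injective (eq _ _)   (all _)      (() , _)
  formTagBody-injective (Tr _)     (eq _ _)     (() , _)
  formTagBody-injective (Tr _)     (neg _)      (() , _)
  formTagBody-injective (Tr _)     (conj _ _)   (() , _)
  formTagBody-injective (Tr _)     (all _)      (() , _)
  formTagBody-injective (neg _)    (eq _ _)     (() , _)
  formTagBody-injective (neg _)    (Tr _)       (() , _)
  formTagBody-injective (neg _)    (conj _ _)   (() , _)
  formTagBody-injective (neg _)    (all _)      (() , _)
  formTagBody-injective (conj _ _) (eq _ _)     (() , _)
  formTagBody-injective (conj _ _) (Tr _)       (() , _)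
  formTagBody-injective (conj _ _) (neg _)      (() , _)
  formTagBody-injective (conj _ _) (all _)      (() , _)
  formTagBody-injective (all _)    (eq _ _)     (() , _)
  formTagBody-injective (all _)    (Tr _)       (() , _)
  formTagBody-injective (all _)    (neg _)      (() , _)
  formTagBody-injective (all _)    (conj _ _)   (() , _)

mutual
  IsTrue-mono : ∀ {S S′ : Pred ℕ 0ℓ} → S ⊆ S′ → ∀ {n} (ρ : Vec ℕ n) φ → IsTrue S ρ φ → IsTrue S′ ρ φ
  IsTrue-mono S⊆S′ ρ (eq t u)   t≡u       = t≡u
  IsTrue-mono S⊆S′ ρ (Tr t)     s         = S⊆S′ s
  IsTrue-mono S⊆S′ ρ (neg φ)    f         = IsFalse-mono S⊆S′ ρ φ f
  IsTrue-mono S⊆S′ ρ (conj φ ψ) (tφ , tψ) = IsTrue-mono S⊆S′ ρ φ tφ , IsTrue-mono S⊆S′ ρ ψ tψ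
  IsTrue-mono S⊆S′ ρ (all φ)    t         = λ k → IsTrue-mono S⊆S′ (k ∷ ρ) φ (t k)

  IsFalse-mono : ∀ {S S′ : Pred ℕ 0ℓ} → S ⊆ S′ → ∀ {n} (ρ : Vec ℕ n) φ → IsFalse S ρ φ → IsFalse S′ ρ φ
  IsFalse-mono S⊆S′ ρ (eq t u)   t≢u                   = t≢u
  IsFalse-mono S⊆S′ ρ (Tr t)     (inj₁ ¬code)          = inj₁ ¬code
  IsFalse-mono S⊆S′ ρ (Tr t)     (inj₂ (ψ , ≡t , s¬ψ)) = inj₂ (ψ , ≡t , S⊆S′ s¬ψ)
  IsFalse-mono S⊆S′ ρ (neg φ)    t                     = IsTrue-mono S⊆S′ ρ φ t
  IsFalse-mono S⊆S′ ρ (conj φ ψ) (inj₁ fφ)             = inj₁ (IsFalse-mono S⊆S′ ρ φ fφ)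
  IsFalse-mono S⊆S′ ρ (conj φ ψ) (inj₂ fψ)             = inj₂ (IsFalse-mono S⊆S′ ρ ψ fψ)
  IsFalse-mono S⊆S′ ρ (all φ)    (k , f)               = k , IsFalse-mono S⊆S′ (k ∷ ρ) φ f

IsTrue⇒¬IsFalse : ∀ {S : Pred ℕ 0ℓ} → (∀ m → S m → IsSentenceCode m) →
                  (∀ φ → ¬ (S ⌜ φ ⌝ × S ⌜ neg φ ⌝)) →
                  ∀ {n} (ρ : Vec ℕ n) φ → IsTrue S ρ φ → ¬ IsFalse S ρ φ
IsTrue⇒¬IsFalse codes cons ρ (eq t u)   t≡u      t≢u                   = t≢u t≡u
IsTrue⇒¬IsFalse codes cons ρ (Tr t)     s        (inj₁ ¬code)          = ¬code (codes _ s)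
IsTrue⇒¬IsFalse {S} codes cons ρ (Tr t) s        (inj₂ (ψ , ≡t , s¬ψ)) = cons ψ (subst S (sym ≡t) s , s¬ψ)
IsTrue⇒¬IsFalse codes cons ρ (neg φ)    f        t                     = IsTrue⇒¬IsFalse codes cons ρ φ t f
IsTrue⇒¬IsFalse codes cons ρ (conj φ ψ) (tφ , _) (inj₁ fφ)             = IsTrue⇒¬IsFalse codes cons ρ φ tφ fφ
IsTrue⇒¬IsFalse codes cons ρ (conj φ ψ) (_ , tψ) (inj₂ fψ)             = IsTrue⇒¬IsFalse codes cons ρ ψ tψ fψ
IsTrue⇒¬IsFalse codes cons ρ (all φ)    t        (k , f)               = IsTrue⇒¬IsFalse codes cons (k ∷ ρ) φ (t k) f

TrueIn⇒¬FalseIn : (w : FIX) (φ : Sentence) → TrueIn (FixedPoint.S w) φ → ¬ FalseIn (FixedPoint.S w) φ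
TrueIn⇒¬FalseIn w = IsTrue⇒¬IsFalse (FixedPoint.onlyCodes w) (FixedPoint.consistent w) []

module KnasterTarski (lem : ExcludedMiddle (lsuc 0ℓ)) {A : Set}
                     (Φ : Pred A 0ℓ → Pred A 0ℓ) (Φ-mono : ∀ {P Q} → P ⊆ Q → Φ P ⊆ Φ Q) where

  -- The intersection of all Φ-closed predicates lives in Set₁; excluded middle resizes it to Set.
  μ : Pred A 0ℓ
  μ a = True (lem {(P : Pred A 0ℓ) → Φ P ⊆ P → P a})

  μ-least : ∀ {P} → Φ P ⊆ P → μ ⊆ P
  μ-least closed μa = toWitness μa _ closed

  Φμ⊆μ : Φ μ ⊆ μ
  Φμ⊆μ Φμa = fromWitness λ P closed → closed (Φ-mono (μ-least closed) Φμa)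

  μ⊆Φμ : μ ⊆ Φ μ
  μ⊆Φμ = μ-least (Φ-mono Φμ⊆μ)

Jump : Pred ℕ 0ℓ → Pred ℕ 0ℓ
Jump S m = Σ Sentence λ φ → ⌜ φ ⌝ ≡ m × TrueIn S φ

Jump-mono : ∀ {S S′ : Pred ℕ 0ℓ} → S ⊆ S′ → Jump S ⊆ Jump S′
Jump-mono S⊆S′ (φ , refl , t) = φ , refl , IsTrue-mono S⊆S′ [] φ t

Jump-fixed⇒fixed : ∀ {S : Pred ℕ 0ℓ} → S ⊆ Jump S → Jump S ⊆ S → (φ : Sentence) → S ⌜ φ ⌝ ⇔ TrueIn S φ
Jump-fixed⇒fixed {S} S⊆JS JS⊆S φ = mk⇔ to (λ t → JS⊆S (φ , refl , t))
  where
  to : S ⌜ φ ⌝ → TrueIn S φ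
  to s with ψ , ⌜ψ⌝≡⌜φ⌝ , t ← S⊆JS s = subst (TrueIn S) (code-injective ψ φ ⌜ψ⌝≡⌜φ⌝) t

FixedPoint-Jump-closed : (w : FIX) → Jump (FixedPoint.S w) ⊆ FixedPoint.S w
FixedPoint-Jump-closed w (φ , refl , t) = Equivalence.from (FixedPoint.fixed w φ) t

module _ (lem : ExcludedMiddle (lsuc 0ℓ)) where
  open KnasterTarski lem Jump Jump-mono

  -- The given fixed point is only needed to see that μ is consistent.
  leastFixedPoint : FIX → FIX
  leastFixedPoint w = record
    { S          = μ
    ; onlyCodes  = λ _ μm → let φ , ⌜φ⌝≡m , _ = μ⊆Φμ μm in φ , ⌜φ⌝≡m
    ; fixed      = Jump-fixed⇒fixed μ⊆Φμ Φμ⊆μ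
    ; consistent = λ φ (μφ , μ¬φ) → FixedPoint.consistent w φ (μ⊆w μφ , μ⊆w μ¬φ)
    }
    where
    μ⊆w : μ ⊆ FixedPoint.S w
    μ⊆w = μ-least (FixedPoint-Jump-closed w)

  leastFixedPoint-⊆ : (w v : FIX) → FixedPoint.S (leastFixedPoint w) ⊆ FixedPoint.S v
  leastFixedPoint-⊆ _ v = μ-least (FixedPoint-Jump-closed v)

module _ (⋆ : Realization) where

  ⇒-intro : ∀ {w} A B → (w ⊩[ ⋆ ] A → w ⊩[ ⋆ ] B) → w ⊩[ ⋆ ] (A ⇒ B)
  ⇒-intro _ _ f (a , ¬b) = ¬b (f a)

  ⇒-elim : DoubleNegationElimination (lsuc 0ℓ) → ∀ {w} A B → w ⊩[ ⋆ ] (A ⇒ B) → w ⊩[ ⋆ ] A → w ⊩[ ⋆ ] B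
  ⇒-elim dne _ _ a⇒b a = dne λ ¬b → a⇒b (a , ¬b)

  psubst-reflects : ∀ w σ (val : ℕ → Bool) → (∀ i → Reflects (w ⊩[ ⋆ ] σ i) (val i)) →
                    ∀ p → Reflects (w ⊩[ ⋆ ] psubst σ p) (pval val p)
  psubst-reflects w σ val atoms (atom i)    = atoms i
  psubst-reflects w σ val atoms (pneg p)    = ¬-reflects (psubst-reflects w σ val atoms p)
  psubst-reflects w σ val atoms (pconj p q) =
    psubst-reflects w σ val atoms p ×-reflects psubst-reflects w σ val atoms q

  taut-sound : ExcludedMiddle (lsuc 0ℓ) → ∀ p → Tautology p → ∀ σ → FIX⊩[ ⋆ ] psubst σ p
  taut-sound lem p tautology σ w =
    invert (subst (Reflects _) (tautology val) (psubst-reflects w σ val (λ _ → proof lem) p))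
    where
    val : ℕ → Bool
    val i = does (lem {w ⊩[ ⋆ ] σ i})

  axK-sound : DoubleNegationElimination (lsuc 0ℓ) → ∀ A B → FIX⊩[ ⋆ ] (□ (A ⇒ B) ⇒ (□ A ⇒ □ B))
  axK-sound dne A B w = ⇒-intro {w} (□ (A ⇒ B)) (□ A ⇒ □ B) λ □A⇒B →
    ⇒-intro {w} (□ A) (□ B) λ □A v → ⇒-elim dne A B (□A⇒B v) (□A v)

  axT-sound : ∀ A → FIX⊩[ ⋆ ] (□ A ⇒ A)
  axT-sound A w = ⇒-intro (□ A) A λ □A → □A w

  ax5-sound : ∀ A → FIX⊩[ ⋆ ] (◇ A ⇒ □ (◇ A))
  ax5-sound A w = ⇒-intro {w} (◇ A) (□ (◇ A)) λ ◇A _ → ◇A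

  axCon-sound : ∀ x → FIX⊩[ ⋆ ] ¬ₘ (T x ∧ₘ F x)
  axCon-sound x w (lift t , lift f) = TrueIn⇒¬FalseIn w (⋆ x) t f

  axGround-sound : ExcludedMiddle (lsuc 0ℓ) → ∀ x → FIX⊩[ ⋆ ] ((◇ (T x) ∧ₘ ◇ (F x)) ⇒ ◇ (N x))
  axGround-sound lem x w ((◇T , ◇F) , ¬◇N) = ¬◇N λ □¬N → □¬N μ (¬T , ¬F)
    where
    μ : FIX
    μ = leastFixedPoint lem w
    ¬T : ¬ μ ⊩[ ⋆ ] T x
    ¬T (lift t) = ◇F λ v (lift f) →
      TrueIn⇒¬FalseIn v (⋆ x) (IsTrue-mono (leastFixedPoint-⊆ lem w v) [] (⋆ x) t) f
    ¬F : ¬ μ ⊩[ ⋆ ] F x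
    ¬F (lift f) = ◇T λ v (lift t) →
      TrueIn⇒¬FalseIn v (⋆ x) t (IsFalse-mono (leastFixedPoint-⊆ lem w v) [] (⋆ x) f)

mainTheorem3 : ExcludedMiddle (lsuc 0ℓ) →
    (⋆ : Realization) (φ : MForm) → ThmS5CG φ → FIX⊩[ ⋆ ] φ
mainTheorem3 lem ⋆ _ (taut p tautology σ) = taut-sound ⋆ lem p tautology σ
mainTheorem3 lem ⋆ _ (axK A B)            = axK-sound ⋆ (em⇒dne lem) A B
mainTheorem3 lem ⋆ _ (axT A)              = axT-sound ⋆ A
mainTheorem3 lem ⋆ _ (ax5 A)              = ax5-sound ⋆ A
mainTheorem3 lem ⋆ _ (axCon x)            = axCon-sound ⋆ x
mainTheorem3 lem ⋆ _ (axGround x)         = axGround-sound ⋆ lem x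
mainTheorem3 lem ⋆ _ (mp {A} {B} ⊢A⇒B ⊢A) w =
  ⇒-elim ⋆ (em⇒dne lem) A B (mainTheorem3 lem ⋆ _ ⊢A⇒B w) (mainTheorem3 lem ⋆ _ ⊢A w)
mainTheorem3 lem ⋆ _ (nec ⊢A) _           = mainTheorem3 lem ⋆ _ ⊢A
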